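{- Let $p$ be a positive integer. There is a bijection between the set of arrays $\begin{pmatrix}\pi_{1,1}&\pi_{1,2}\\ &\pi_{2,2}\end{pmatrix}$ of positive integers with $\pi_{1,1}>\pi_{1,2}\ge\pi_{2,2}$ and $\pi_{1,1}+\pi_{1,2}+\pi_{2,2}=p$ (shifted $(1,0)$-plane partitions of shape $(2,2)$ and norm $p$), and the set $P_{3,p-1}$ of partitions of $p-1$ into $3$ (not necessarily distinct) positive parts, i.e. triples $(\pi'_1,\pi'_2,\pi'_3)$ of positive integers with $\pi'_1\ge\pi'_2\ge\pi'_3$ and $\pi'_1+\pi'_2+\pi'_3=p-1$. -}

module Defs where

open import Data.Nat using (ℕ; _+_; _∸_; _≤_; _<_; _≥_; _>_)
open import Data.Product using (Σ; _×_)

record Triple : Set where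
  constructor mkTriple
  field
    a b c : ℕ

IsShiftedPP : ℕ → Triple → Set
IsShiftedPP p (mkTriple π11 π12 π22) =
  π11 ≥ 1 × π12 ≥ 1 × π22 ≥ 1 × π11 > π12 × π12 ≥ π22 × π11 + π12 + π22 ≡′ p
  where
  open import Relation.Binary.PropositionalEquality using () renaming (_≡_ to _≡′_)

ShiftedPP : ℕ → Set
ShiftedPP p = Σ Triple (IsShiftedPP p)

IsPartition3 : ℕ → Triple → Set
IsPartition3 n (mkTriple x y z) =
  x ≥ 1 × y ≥ 1 × z ≥ 1 × x ≥ y × y ≥ z × x + y + z ≡′ n
  where
  open import Relation.Binary.PropositionalEquality using () renaming (_≡_ to _≡′_)

P3 : ℕ → Set
P3 n = Σ Triple (IsPartition3 n)

-- Subtracting one from the largest part π₁₁ turns the strict inequality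
-- π₁₁ > π₁₂ into π₁₁ - 1 ≥ π₁₂ and lowers the norm by one; adding it back
-- inverts this. Both predicates are propositions, so the two composites are
-- identities as soon as they are identities on the underlying triples.
module Submission where

open import Defs
open import Data.Nat using (ℕ; suc; _∸_; _≤_; z≤n; s≤s)
open import Data.Nat.Properties using (≤-trans; ≤-irrelevant; ≡-irrelevant)
open import Data.Product using (Σ; _×_; _,_)
open import Function.Bundles using (_⤖_; mk↔ₛ′)
open import Function.Properties.Inverse using (↔⇒⤖)
open import Relation.Binary.PropositionalEquality using (_≡_; refl; cong; cong₂)
open import Relation.Nullary.Irrelevant using (Irrelevant)

×-irrelevant : ∀ {A B : Set} → Irrelevant A → Irrelevant B → Irrelevant (A × B)
×-irrelevant irrA irrB (a , b) (a′ , b′) = cong₂ _,_ (irrA a a′) (irrB b b′)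

Σ-≡-of-irrelevant : ∀ {A : Set} {P : A → Set} → (∀ {x} → Irrelevant (P x)) →
                    ∀ {x} (p q : P x) → _≡_ {A = Σ A P} (x , p) (x , q)
Σ-≡-of-irrelevant irrP {x} p q = cong (x ,_) (irrP p q)

isShiftedPP-irrelevant : ∀ {p t} → Irrelevant (IsShiftedPP p t)
isShiftedPP-irrelevant =
  ×-irrelevant ≤-irrelevant (×-irrelevant ≤-irrelevant (×-irrelevant ≤-irrelevant
    (×-irrelevant ≤-irrelevant (×-irrelevant ≤-irrelevant ≡-irrelevant))))

isPartition3-irrelevant : ∀ {n t} → Irrelevant (IsPartition3 n t)
isPartition3-irrelevant =
  ×-irrelevant ≤-irrelevant (×-irrelevant ≤-irrelevant (×-irrelevant ≤-irrelevant
    (×-irrelevant ≤-irrelevant (×-irrelevant ≤-irrelevant ≡-irrelevant))))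

decrementLargestPart : ∀ n → ShiftedPP (suc n) → P3 n
decrementLargestPart n (mkTriple (suc a) b c , _ , b≥1 , c≥1 , s≤s a≥b , b≥c , refl) =
  mkTriple a b c , ≤-trans b≥1 a≥b , b≥1 , c≥1 , a≥b , b≥c , refl

incrementLargestPart : ∀ n → P3 n → ShiftedPP (suc n)
incrementLargestPart n (mkTriple a b c , _ , b≥1 , c≥1 , a≥b , b≥c , refl) =
  mkTriple (suc a) b c , s≤s z≤n , b≥1 , c≥1 , s≤s a≥b , b≥c , refl

decrement∘increment : ∀ n (π : P3 n) → decrementLargestPart n (incrementLargestPart n π) ≡ π
decrement∘increment n (mkTriple a b c , _ , _ , _ , _ , _ , refl) =
  Σ-≡-of-irrelevant isPartition3-irrelevant _ _

increment∘decrement : ∀ n (π : ShiftedPP (suc n)) → incrementLargestPart n (decrementLargestPart n π) ≡ π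
increment∘decrement n (mkTriple (suc a) b c , _ , _ , _ , s≤s _ , _ , refl) =
  Σ-≡-of-irrelevant isShiftedPP-irrelevant _ _

mainTheorem16 : (p : ℕ) → 1 ≤ p → ShiftedPP p ⤖ P3 (p ∸ 1)
mainTheorem16 (suc n) _ =
  ↔⇒⤖ (mk↔ₛ′ (decrementLargestPart n) (incrementLargestPart n)
              (decrement∘increment n) (increment∘decrement n))
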